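{- For all integers $n\ge0$ and $k>1$, $$s_n(UH_2^{k-1}D)=1+\sum_{h=1}^{n}\ \sum_{i=0}^{\min\{k-2,\,n-h\}}\left(\!\!\binom{2h-1}{i}\!\!\right)(n-h-i+1)\,C_h .$$
   Context: Schröder paths: - A Schröder path is a finite word over $\{U,D,H_2\}$, viewed as a lattice path from $(0,0)$ with steps $U=(1,1)$, $D=(1,-1)$, $H_2=(2,0)$, ending on the $x$-axis and never going below it. The empty path is allowed. - Its semilength is (number of $U$'s) + (number of $H_2$'s). Notation and avoidance: - $UH_2^{k-1}D$ is the word $U$, then $k-1$ letters $H_2$, then $D$. - $Q$ avoids $P$ if $P$ is not a (not necessarily contiguous) subword of $Q$. - $s_n(P)$ is the number of Schröder paths of semilength $n$ avoiding $P$. Numbers appearing in the formula: - $C_h=\frac{1}{h+1}\binom{2h}{h}$ are the Catalan numbers. - $\left(\!\binom{m}{i}\!\right)=\binom{m+i-1}{i}$ is the multiset coefficient, i.e. the number of multisets of size $i$ from an $m$-element set. -}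

module Defs where

open import Data.Nat using (ℕ; zero; suc; _+_; _*_; _∸_; _⊓_)
open import Data.Nat.Combinatorics using (_C_)
open import Data.Nat.DivMod using (_/_)
open import Data.List using (List; []; _∷_; length; replicate; _++_)
open import Relation.Binary.PropositionalEquality using (_≡_)
open import Relation.Nullary using (¬_)
open import Data.List.Membership.Propositional using (_∈_)
open import Data.List.Relation.Unary.Unique.Propositional using (Unique)
open import Data.Product using (Σ; _×_)
open import Function.Bundles using (_⇔_)

-- Steps of a Schröder path: U = (1,1), D = (1,-1), H₂ = (2,0).
data Step : Set where
  U D H₂ : Step

Word : Set
Word = List Step

-- Lattice path starting at height h, never going below the x-axis,
-- ending on the x-axis.
data PathFrom : ℕ → Word → Set where
  done : PathFrom zero []
  stepU : ∀ {h w} → PathFrom (suc h) w → PathFrom h (U ∷ w)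
  stepD : ∀ {h w} → PathFrom h w → PathFrom (suc h) (D ∷ w)
  stepH : ∀ {h w} → PathFrom h w → PathFrom h (H₂ ∷ w)

IsSchroder : Word → Set
IsSchroder = PathFrom zero

semilength : Word → ℕ
semilength [] = zero
semilength (U ∷ w) = suc (semilength w)
semilength (D ∷ w) = semilength w
semilength (H₂ ∷ w) = suc (semilength w)

data Subword : Word → Word → Set where
  nil  : ∀ {w} → Subword [] w
  keep : ∀ {x p w} → Subword p w → Subword (x ∷ p) (x ∷ w)
  skip : ∀ {x p w} → Subword p w → Subword p (x ∷ w)

Avoids : Word → Word → Set
Avoids q p = ¬ Subword p q

pattern-UHD : ℕ → Word
pattern-UHD k = U ∷ (replicate (k ∸ 1) H₂ ++ (D ∷ []))

-- s_n(P) = m : some duplicate-free list enumerates exactly the Schröder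
-- paths of semilength n avoiding P, and it has length m.
CountIs : ℕ → Word → ℕ → Set
CountIs n P m =
  Σ (List Word) λ ws →
    Unique ws ×
    (∀ w → (w ∈ ws) ⇔ (IsSchroder w × semilength w ≡ n × Avoids w P)) ×
    length ws ≡ m

catalan : ℕ → ℕ
catalan h = ((2 * h) C h) / suc h

multichoose : ℕ → ℕ → ℕ
multichoose m i = ((m + i) ∸ 1) C i

sumTo : ℕ → (ℕ → ℕ) → ℕ
sumTo zero f = f zero
sumTo (suc u) f = sumTo u f + f (suc u)

sumFrom1 : ℕ → (ℕ → ℕ) → ℕ
sumFrom1 zero f = zero
sumFrom1 (suc n) f = sumFrom1 n f + f (suc n)

formula : ℕ → ℕ → ℕ
formula n k =
  1 + sumFrom1 n (λ h →
        sumTo ((k ∸ 2) ⊓ (n ∸ h)) (λ i →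
          multichoose (2 * h ∸ 1) i * ((n ∸ h ∸ i) + 1) * catalan h))

-- A Schröder path avoids U H₂^(k-1) D iff at most k - 2 flat steps lie between its first U and
-- its last D. So an avoider other than H₂^n is H₂^a U v H₂^b, where v goes from height 1 down to
-- the axis, does not end with H₂, and has i ≤ k - 2 flat steps. If U v has h up-steps, the U/D
-- skeleton of v is one of ballot(h-1, 1) = C_h paths, and its i flat steps are spread over the
-- 2h - 1 gaps in front of its U/D steps in ((2h-1, i)) ways; finally a + b = n - h - i leaves
-- n - h - i + 1 choices for (a, b).
module Submission where

open import Defs
open import Data.Nat using (ℕ; zero; suc; pred; _+_; _*_; _∸_; _⊓_; _≤_; _<_; z≤n; s≤s; _≤?_; s≤s⁻¹)
open import Data.Nat.Properties
open import Data.Nat.Combinatorics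
  using (_C_; nCk+nC[k+1]≡[n+1]C[k+1]; k>n⇒nCk≡0; nCn≡1; nC1≡n; nCk≡nC[n∸k])
open import Data.Nat.DivMod using (_/_; m*n/n≡m)
open import Data.Nat.Tactic.RingSolver using (solve-∀)
open import Data.List using (List; []; _∷_; length; replicate; _++_; map; head)
open import Data.List.Properties using (length-++; length-map; ++-assoc; ++-cancelˡ; ∷-injectiveˡ; ∷-injectiveʳ)
open import Data.List.Membership.Propositional using (_∈_)
open import Data.List.Membership.Propositional.Properties using (∈-map⁻; ∈-map⁺; ∈-++⁺ˡ; ∈-++⁺ʳ; ∈-++⁻)
open import Data.List.Relation.Unary.Any using (here; there)
open import Data.List.Relation.Unary.Unique.Propositional using (Unique)
open import Data.List.Relation.Binary.Disjoint.Propositional using (Disjoint)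
open import Data.List.Relation.Unary.Unique.Propositional.Properties using (++⁺; map⁺)
open import Data.List.Relation.Unary.AllPairs using ([]; _∷_)
import Data.List.Relation.Unary.All as All
open import Data.Product using (_×_; _,_; proj₁; proj₂; ∃-syntax)
open import Data.Sum using (_⊎_; inj₁; inj₂)
open import Data.Maybe using (just; nothing)
open import Data.Empty using (⊥-elim)
open import Data.Unit using (⊤)
open import Function using (_∘_; case_of_)
open import Relation.Binary.PropositionalEquality
open import Relation.Nullary using (¬_; yes; no)
open import Function.Bundles using (_⇔_; mk⇔; module Equivalence)
open ≡-Reasoning

private variable
  A B : Set

concatUpTo : ℕ → (ℕ → List A) → List A
concatUpTo zero    f = f zero
concatUpTo (suc u) f = concatUpTo u f ++ f (suc u)

concatFrom1 : ℕ → (ℕ → List A) → List A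
concatFrom1 zero    f = []
concatFrom1 (suc n) f = concatUpTo n (f ∘ suc)

sumFrom1≡sumTo : ∀ n f → sumFrom1 (suc n) f ≡ sumTo n (f ∘ suc)
sumFrom1≡sumTo zero    f = refl
sumFrom1≡sumTo (suc n) f = cong (_+ f (2 + n)) (sumFrom1≡sumTo n f)

sumTo-cong : ∀ u {f g} → (∀ x → f x ≡ g x) → sumTo u f ≡ sumTo u g
sumTo-cong zero    f≗g = f≗g zero
sumTo-cong (suc u) f≗g = cong₂ _+_ (sumTo-cong u f≗g) (f≗g (suc u))

sumFrom1-cong : ∀ n {f g} → (∀ q → f (suc q) ≡ g (suc q)) → sumFrom1 n f ≡ sumFrom1 n g
sumFrom1-cong zero    f≗g = refl
sumFrom1-cong (suc n) f≗g = cong₂ _+_ (sumFrom1-cong n f≗g) (f≗g n)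

sumTo-const : ∀ u c → sumTo u (λ _ → c) ≡ (u + 1) * c
sumTo-const zero    c = sym (+-identityʳ c)
sumTo-const (suc u) c = trans (cong (_+ c) (sumTo-const u c)) (+-comm ((u + 1) * c) c)

length-concatUpTo : ∀ u (f : ℕ → List A) → length (concatUpTo u f) ≡ sumTo u (length ∘ f)
length-concatUpTo zero    f = refl
length-concatUpTo (suc u) f = trans (length-++ (concatUpTo u f)) (cong (_+ length (f (suc u))) (length-concatUpTo u f))

length-concatFrom1 : ∀ n (f : ℕ → List A) → length (concatFrom1 n f) ≡ sumFrom1 n (length ∘ f)
length-concatFrom1 zero    f = refl
length-concatFrom1 (suc n) f = trans (length-concatUpTo n (f ∘ suc)) (sym (sumFrom1≡sumTo n (length ∘ f)))

∈-concatUpTo⁻ : ∀ u (f : ℕ → List A) {x} → x ∈ concatUpTo u f → ∃[ a ] a ≤ u × x ∈ f a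
∈-concatUpTo⁻ zero    f x∈ = zero , z≤n , x∈
∈-concatUpTo⁻ (suc u) f x∈ with ∈-++⁻ (concatUpTo u f) x∈
... | inj₂ x∈last = suc u , ≤-refl , x∈last
... | inj₁ x∈init with ∈-concatUpTo⁻ u f x∈init
...   | a , a≤u , x∈fa = a , m≤n⇒m≤1+n a≤u , x∈fa

∈-concatUpTo⁺ : ∀ u (f : ℕ → List A) {x a} → a ≤ u → x ∈ f a → x ∈ concatUpTo u f
∈-concatUpTo⁺ zero    f z≤n x∈ = x∈
∈-concatUpTo⁺ (suc u) f a≤1+u x∈ with m≤n⇒m<n∨m≡n a≤1+u
... | inj₁ a<1+u = ∈-++⁺ˡ (∈-concatUpTo⁺ u f (s≤s⁻¹ a<1+u) x∈)
... | inj₂ refl  = ∈-++⁺ʳ (concatUpTo u f) x∈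

∈-concatFrom1⁻ : ∀ n (f : ℕ → List A) {x} → x ∈ concatFrom1 n f → ∃[ q ] suc q ≤ n × x ∈ f (suc q)
∈-concatFrom1⁻ (suc n) f x∈ with ∈-concatUpTo⁻ n (f ∘ suc) x∈
... | q , q≤n , x∈fq = q , s≤s q≤n , x∈fq

∈-concatFrom1⁺ : ∀ n (f : ℕ → List A) {x q} → suc q ≤ n → x ∈ f (suc q) → x ∈ concatFrom1 n f
∈-concatFrom1⁺ (suc n) f (s≤s q≤n) = ∈-concatUpTo⁺ n (f ∘ suc) q≤n

Unique-concatUpTo : ∀ u {f : ℕ → List A} (tag : A → ℕ) → (∀ a → Unique (f a)) →
                    (∀ {a x} → x ∈ f a → tag x ≡ a) → Unique (concatUpTo u f)
Unique-concatUpTo zero    tag unique tagged = unique zero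
Unique-concatUpTo (suc u) {f} tag unique tagged =
  ++⁺ (Unique-concatUpTo u tag unique tagged) (unique (suc u)) disjoint
  where
  disjoint : ∀ {x} → ¬ (x ∈ concatUpTo u f × x ∈ f (suc u))
  disjoint (x∈init , x∈last) with ∈-concatUpTo⁻ u f x∈init
  ... | a , a≤u , x∈fa = <⇒≢ (s≤s a≤u) (trans (sym (tagged x∈fa)) (tagged x∈last))

Unique-concatFrom1 : ∀ n {f : ℕ → List A} (tag : A → ℕ) → (∀ h → Unique (f h)) →
                     (∀ {h x} → x ∈ f h → tag x ≡ h) → Unique (concatFrom1 n f)
Unique-concatFrom1 zero    tag unique tagged = []
Unique-concatFrom1 (suc n) tag unique tagged = Unique-concatUpTo n (pred ∘ tag) (unique ∘ suc) (cong pred ∘ tagged)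

Unique-map-injectiveOn : ∀ (f : A → B) {xs} → Unique xs →
                         (∀ {x y} → x ∈ xs → y ∈ xs → f x ≡ f y → x ≡ y) → Unique (map f xs)
Unique-map-injectiveOn f {[]}     []             injective = []
Unique-map-injectiveOn f {x ∷ xs} (x∉xs ∷ unique) injective =
  All.tabulate fx∉ ∷ Unique-map-injectiveOn f unique (λ y∈ z∈ → injective (there y∈) (there z∈))
  where
  fx∉ : ∀ {z} → z ∈ map f xs → f x ≢ z
  fx∉ z∈ fx≡z with ∈-map⁻ f z∈
  ... | y , y∈xs , refl = All.lookup x∉xs y∈xs (injective (here refl) (there y∈xs) fx≡z)

-- Binomial coefficients and ballot numbers

multichoose-suc : ∀ m i → multichoose (suc m) (suc i) ≡ multichoose (suc m) i + multichoose m (suc i)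
multichoose-suc m i = begin
  (suc m + suc i ∸ 1) C suc i      ≡⟨ cong (_C suc i) (+-suc m i) ⟩
  suc (m + i) C suc i              ≡⟨ nCk+nC[k+1]≡[n+1]C[k+1] (m + i) i ⟨
  (m + i) C i + (m + i) C suc i    ≡⟨ cong (λ x → (m + i) C i + (x ∸ 1) C suc i) (+-suc m i) ⟨
  (m + i) C i + (m + suc i ∸ 1) C suc i ∎

multichoose-zero : ∀ i → multichoose 0 (suc i) ≡ 0
multichoose-zero i = k>n⇒nCk≡0 (n<1+n i)

[1+k]*[1+n]C[1+k]≡[1+n]*nCk : ∀ n k → suc k * (suc n C suc k) ≡ suc n * (n C k)
[1+k]*[1+n]C[1+k]≡[1+n]*nCk zero    zero    = refl
[1+k]*[1+n]C[1+k]≡[1+n]*nCk zero    (suc k) = *-zeroʳ (2 + k)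
[1+k]*[1+n]C[1+k]≡[1+n]*nCk (suc n) zero    =
  trans (*-identityˡ ((2 + n) C 1)) (trans (nC1≡n (2 + n)) (sym (*-identityʳ (2 + n))))
[1+k]*[1+n]C[1+k]≡[1+n]*nCk (suc n) (suc k) = begin
  (2 + k) * ((2 + n) C (2 + k))                  ≡⟨ cong ((2 + k) *_) (nCk+nC[k+1]≡[n+1]C[k+1] (1 + n) (1 + k)) ⟨
  (2 + k) * (X + Y)                              ≡⟨ expand k X Y ⟩
  (1 + k) * X + X + (2 + k) * Y                  ≡⟨ cong₂ (λ a b → a + X + b)
                                                      ([1+k]*[1+n]C[1+k]≡[1+n]*nCk n k)
                                                      ([1+k]*[1+n]C[1+k]≡[1+n]*nCk n (suc k)) ⟩
  (1 + n) * (n C k) + X + (1 + n) * (n C suc k)  ≡⟨ collect n (n C k) (n C suc k) X ⟩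
  (1 + n) * (n C k + n C suc k) + X              ≡⟨ cong (λ a → (1 + n) * a + X) (nCk+nC[k+1]≡[n+1]C[k+1] n k) ⟩
  (1 + n) * X + X                                ≡⟨ +-comm ((1 + n) * X) X ⟩
  (2 + n) * X                                    ∎
  where
  X = suc n C suc k
  Y = suc n C suc (suc k)
  expand : ∀ k x y → (2 + k) * (x + y) ≡ (1 + k) * x + x + (2 + k) * y
  expand = solve-∀
  collect : ∀ n a b x → (1 + n) * a + x + (1 + n) * b ≡ (1 + n) * (a + b) + x
  collect = solve-∀

-- 2p + j, the number of U and D steps of a path from height j with p up-steps.
udSteps : ℕ → ℕ → ℕ
udSteps zero    j = j
udSteps (suc p) j = suc (udSteps p (suc j))

udSteps-suc : ∀ p j → udSteps p (suc j) ≡ suc (udSteps p j)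
udSteps-suc zero    j = refl
udSteps-suc (suc p) j = cong suc (udSteps-suc p (suc j))

udSteps≡p+p+j : ∀ p j → udSteps p j ≡ p + (p + j)
udSteps≡p+p+j zero    j = refl
udSteps≡p+p+j (suc p) j = cong suc (begin
  udSteps p (suc j)    ≡⟨ udSteps≡p+p+j p (suc j) ⟩
  p + (p + suc j)      ≡⟨ cong (p +_) (+-suc p j) ⟩
  p + suc (p + j)      ∎)

udSteps-1 : ∀ p → udSteps p 1 ≡ p + suc p
udSteps-1 p = trans (udSteps≡p+p+j p 1) (cong (p +_) (+-comm p 1))

-- The number of U/D paths from height j down to the axis with p up-steps.
ballot : ℕ → ℕ → ℕ
ballot zero    j       = 1
ballot (suc p) zero    = ballot p 1
ballot (suc p) (suc j) = ballot p (suc (suc j)) + ballot (suc p) j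

-- b = M C N - M C (N + 1), stated without truncated subtraction.
BinomialGap : ℕ → ℕ → ℕ → Set
BinomialGap b M N = b + M C suc N ≡ M C N

BinomialGap-pascal : ∀ {x y M N} → BinomialGap x M (suc N) → BinomialGap y M N →
                     BinomialGap (x + y) (suc M) (suc N)
BinomialGap-pascal {x} {y} {M} {N} gapˣ gapʸ = begin
  (x + y) + suc M C suc (suc N)                  ≡⟨ cong ((x + y) +_) (nCk+nC[k+1]≡[n+1]C[k+1] M (suc N)) ⟨
  (x + y) + (M C suc N + M C suc (suc N))        ≡⟨ shuffle x y (M C suc N) (M C suc (suc N)) ⟩
  (x + M C suc (suc N)) + (y + M C suc N)        ≡⟨ cong₂ _+_ gapˣ gapʸ ⟩
  M C suc N + M C N                              ≡⟨ +-comm (M C suc N) (M C N) ⟩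
  M C N + M C suc N                              ≡⟨ nCk+nC[k+1]≡[n+1]C[k+1] M N ⟩
  suc M C suc N                                  ∎
  where
  shuffle : ∀ x y a b → (x + y) + (a + b) ≡ (x + b) + (y + a)
  shuffle = solve-∀

[2p+1]Cp≡[2p+1]C[1+p] : ∀ p → udSteps p 1 C p ≡ udSteps p 1 C suc p
[2p+1]Cp≡[2p+1]C[1+p] p rewrite udSteps-1 p = sym (begin
  (p + suc p) C suc p                   ≡⟨ nCk≡nC[n∸k] (m≤n+m (suc p) p) ⟩
  (p + suc p) C (p + suc p ∸ suc p)     ≡⟨ cong ((p + suc p) C_) (m+n∸n≡m p (suc p)) ⟩
  (p + suc p) C p                       ∎)

ballot-gap : ∀ p j → BinomialGap (ballot p j) (udSteps p j) (p + j)
ballot-gap zero    j       = trans (cong (1 +_) (k>n⇒nCk≡0 (n<1+n j))) (sym (nCn≡1 j))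
ballot-gap (suc p) zero    =
  subst₂ (λ b N → BinomialGap b (udSteps (suc p) 0) (suc N)) (+-identityʳ (ballot p 1)) (sym (+-identityʳ p))
    (BinomialGap-pascal {M = M} {N = p} (subst (BinomialGap (ballot p 1) M) (+-comm p 1) (ballot-gap p 1)) middle)
  where
  M = udSteps p 1
  middle : BinomialGap 0 M p
  middle = sym ([2p+1]Cp≡[2p+1]C[1+p] p)
ballot-gap (suc p) (suc j) = BinomialGap-pascal {M = M} {N = p + suc j}
  (subst (BinomialGap (ballot p (suc (suc j))) M) (+-suc p (suc j)) (ballot-gap p (suc (suc j))))
  (subst₂ (BinomialGap (ballot (suc p) j)) (sym (udSteps-suc p (suc j))) (sym (+-suc p j)) (ballot-gap (suc p) j))
  where
  M = udSteps p (suc (suc j))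

private
  cancel-gap : ∀ q b X Y → b + Y ≡ X → (2 + q) * (X + Y) ≡ (2 + q + q) * X → (2 + q) * b ≡ X + X
  cancel-gap q b X Y gap absorb = +-cancelʳ-≡ (q * X) _ _ (begin
    (2 + q) * b + q * X        ≡⟨ cong ((2 + q) * b +_) qX≡[2+q]Y ⟩
    (2 + q) * b + (2 + q) * Y  ≡⟨ *-distribˡ-+ (2 + q) b Y ⟨
    (2 + q) * (b + Y)          ≡⟨ cong ((2 + q) *_) gap ⟩
    (2 + q) * X                ≡⟨ split₁ q X ⟩
    X + X + q * X              ∎)
    where
    split₁ : ∀ q X → (2 + q) * X ≡ X + X + q * X
    split₁ = solve-∀
    split₂ : ∀ q X → (2 + q + q) * X ≡ (2 + q) * X + q * X
    split₂ = solve-∀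
    qX≡[2+q]Y : q * X ≡ (2 + q) * Y
    qX≡[2+q]Y = +-cancelˡ-≡ ((2 + q) * X) _ _ (begin
      (2 + q) * X + q * X        ≡⟨ split₂ q X ⟨
      (2 + q + q) * X            ≡⟨ absorb ⟨
      (2 + q) * (X + Y)          ≡⟨ *-distribˡ-+ (2 + q) X Y ⟩
      (2 + q) * X + (2 + q) * Y  ∎)

-- With X = (2q+1) C (q+1): (2q+2) C (q+1) = 2X by symmetry, and absorption turns the gap
-- identity for ballot q 1 into (q+2) * ballot q 1 = 2X.
ballot≡catalan : ∀ q → ballot q 1 ≡ catalan (suc q)
ballot≡catalan q = sym (begin
  ((2 * suc q) C suc q) / (2 + q)   ≡⟨ cong (λ n → (n C suc q) / (2 + q)) 2[1+q]≡1+M ⟩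
  (suc M C suc q) / (2 + q)         ≡⟨ cong (_/ (2 + q)) central ⟩
  (X + X) / (2 + q)                 ≡⟨ cong (_/ (2 + q)) (cancel-gap q (ballot q 1) X Y gap absorb) ⟨
  (2 + q) * ballot q 1 / (2 + q)    ≡⟨ cong (_/ (2 + q)) (*-comm (2 + q) (ballot q 1)) ⟩
  ballot q 1 * (2 + q) / (2 + q)    ≡⟨ m*n/n≡m (ballot q 1) (2 + q) ⟩
  ballot q 1                        ∎)
  where
  M = udSteps q 1
  X = M C suc q
  Y = M C suc (suc q)
  2[1+q]≡1+M : 2 * suc q ≡ suc M
  2[1+q]≡1+M = trans (cong (suc q +_) (+-identityʳ (suc q))) (cong suc (sym (udSteps-1 q)))
  central : suc M C suc q ≡ X + X
  central = trans (sym (nCk+nC[k+1]≡[n+1]C[k+1] M q)) (cong (_+ X) ([2p+1]Cp≡[2p+1]C[1+p] q))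
  gap : ballot q 1 + Y ≡ X
  gap = subst (BinomialGap (ballot q 1) M) (+-comm q 1) (ballot-gap q 1)
  absorb : (2 + q) * (X + Y) ≡ (2 + q + q) * X
  absorb = begin
    (2 + q) * (X + Y)         ≡⟨ cong ((2 + q) *_) (nCk+nC[k+1]≡[n+1]C[k+1] M (suc q)) ⟩
    (2 + q) * (suc M C (2 + q)) ≡⟨ [1+k]*[1+n]C[1+k]≡[1+n]*nCk M (suc q) ⟩
    suc M * X                 ≡⟨ cong (λ n → suc n * X) (udSteps-1 q) ⟩
    suc (q + suc q) * X       ≡⟨ cong (λ n → suc n * X) (+-suc q q) ⟩
    (2 + q + q) * X           ∎

countU : Word → ℕ
countU []       = 0
countU (U ∷ w)  = suc (countU w)
countU (D ∷ w)  = countU w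
countU (H₂ ∷ w) = countU w

countH : Word → ℕ
countH []       = 0
countH (U ∷ w)  = countH w
countH (D ∷ w)  = countH w
countH (H₂ ∷ w) = suc (countH w)

flats : ℕ → Word
flats a = replicate a H₂

semilength-++ : ∀ x y → semilength (x ++ y) ≡ semilength x + semilength y
semilength-++ []       y = refl
semilength-++ (U ∷ x)  y = cong suc (semilength-++ x y)
semilength-++ (D ∷ x)  y = semilength-++ x y
semilength-++ (H₂ ∷ x) y = cong suc (semilength-++ x y)

semilength-flats : ∀ a → semilength (flats a) ≡ a
semilength-flats zero    = refl
semilength-flats (suc a) = cong suc (semilength-flats a)

semilength≡countU+countH : ∀ w → semilength w ≡ countU w + countH w
semilength≡countU+countH []       = refl
semilength≡countU+countH (U ∷ w)  = cong suc (semilength≡countU+countH w)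
semilength≡countU+countH (D ∷ w)  = semilength≡countU+countH w
semilength≡countU+countH (H₂ ∷ w) = trans (cong suc (semilength≡countU+countH w)) (sym (+-suc (countU w) (countH w)))

NoTrailingH : Word → Set
NoTrailingH []          = ⊤
NoTrailingH (x ∷ [])     = x ≢ H₂
NoTrailingH (_ ∷ y ∷ w)  = NoTrailingH (y ∷ w)

NoTrailingH-∷⁻ : ∀ x w → NoTrailingH (x ∷ w) → NoTrailingH w
NoTrailingH-∷⁻ x []      _  = _
NoTrailingH-∷⁻ x (y ∷ w) nt = nt

PathFrom-flats : ∀ b → PathFrom 0 (flats b)
PathFrom-flats zero    = done
PathFrom-flats (suc b) = stepH (PathFrom-flats b)

PathFrom-flats⁻ : ∀ b {j} → PathFrom j (flats b) → j ≡ 0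
PathFrom-flats⁻ zero    done      = refl
PathFrom-flats⁻ (suc b) (stepH p) = PathFrom-flats⁻ b p

PathFrom-flats++ : ∀ a {j x} → PathFrom j x → PathFrom j (flats a ++ x)
PathFrom-flats++ zero    p = p
PathFrom-flats++ (suc a) p = stepH (PathFrom-flats++ a p)

PathFrom-++flats : ∀ b {j x} → PathFrom j x → PathFrom j (x ++ flats b)
PathFrom-++flats b done      = PathFrom-flats b
PathFrom-++flats b (stepU p) = stepU (PathFrom-++flats b p)
PathFrom-++flats b (stepD p) = stepD (PathFrom-++flats b p)
PathFrom-++flats b (stepH p) = stepH (PathFrom-++flats b p)

PathFrom-++flats⁻ : ∀ x b {j} → PathFrom j (x ++ flats b) → PathFrom j x
PathFrom-++flats⁻ []       b p with PathFrom-flats⁻ b p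
... | refl = done
PathFrom-++flats⁻ (U ∷ x)  b (stepU p) = stepU (PathFrom-++flats⁻ x b p)
PathFrom-++flats⁻ (D ∷ x)  b (stepD p) = stepD (PathFrom-++flats⁻ x b p)
PathFrom-++flats⁻ (H₂ ∷ x) b (stepH p) = stepH (PathFrom-++flats⁻ x b p)

PathFrom-endsWithD : ∀ {j v} → PathFrom j v → v ≢ [] → NoTrailingH v → ∃[ v′ ] v ≡ v′ ++ D ∷ []
PathFrom-endsWithD done                  v≢[] _  = ⊥-elim (v≢[] refl)
PathFrom-endsWithD (stepU {w = []} ())
PathFrom-endsWithD (stepD {w = []} _)    _    _  = [] , refl
PathFrom-endsWithD (stepH {w = []} _)    _    nt = ⊥-elim (nt refl)
PathFrom-endsWithD (stepU {w = _ ∷ _} p) _    nt with PathFrom-endsWithD p (λ ()) nt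
... | v′ , v≡v′D = U ∷ v′ , cong (U ∷_) v≡v′D
PathFrom-endsWithD (stepD {w = _ ∷ _} p) _    nt with PathFrom-endsWithD p (λ ()) nt
... | v′ , v≡v′D = D ∷ v′ , cong (D ∷_) v≡v′D
PathFrom-endsWithD (stepH {w = _ ∷ _} p) _    nt with PathFrom-endsWithD p (λ ()) nt
... | v′ , v≡v′D = H₂ ∷ v′ , cong (H₂ ∷_) v≡v′D

-- Paths without a trailing flat step

record Trimmed (p j i : ℕ) (w : Word) : Set where
  constructor trimmed
  field
    path       : PathFrom j w
    upCount    : countU w ≡ p
    flatCount  : countH w ≡ i
    noTrailing : NoTrailingH w

Trimmed-[] : ∀ {p j i} → Trimmed p j i [] → p ≡ 0 × j ≡ 0
Trimmed-[] (trimmed done ups _ _) = sym ups , refl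

Trimmed-no-up : ∀ {i w} → Trimmed 0 0 i w → w ≡ []
Trimmed-no-up {w = []}          _                  = refl
Trimmed-no-up {w = H₂ ∷ []}     (trimmed _ _ _ nt) = ⊥-elim (nt refl)
Trimmed-no-up {w = H₂ ∷ y ∷ w}  (trimmed (stepH path) ups refl nt) with Trimmed-no-up (trimmed path ups refl nt)
... | ()

mutual
  trimmedPaths : ℕ → ℕ → ℕ → List Word
  trimmedPaths p j i = emptyPath p j i ++ (flatFirst p j i ++ stepFirst p j i)

  emptyPath : ℕ → ℕ → ℕ → List Word
  emptyPath zero zero zero = [] ∷ []
  emptyPath _    _    _    = []

  flatFirst : ℕ → ℕ → ℕ → List Word
  flatFirst zero zero _       = []  -- the rest would be empty, leaving H₂ trailing
  flatFirst p    j    zero    = []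
  flatFirst p    j    (suc i) = map (H₂ ∷_) (trimmedPaths p j i)

  stepFirst : ℕ → ℕ → ℕ → List Word
  stepFirst p j i = upFirst p j i ++ downFirst p j i

  upFirst : ℕ → ℕ → ℕ → List Word
  upFirst zero    j i = []
  upFirst (suc p) j i = map (U ∷_) (trimmedPaths p (suc j) i)

  downFirst : ℕ → ℕ → ℕ → List Word
  downFirst p zero    i = []
  downFirst p (suc j) i = map (D ∷_) (trimmedPaths p j i)

Trimmed-H₂∷ : ∀ {p j i v} → v ≢ [] → Trimmed p j i v → Trimmed p j (suc i) (H₂ ∷ v)
Trimmed-H₂∷ {v = []}    v≢[] _                       = ⊥-elim (v≢[] refl)
Trimmed-H₂∷ {v = _ ∷ _} _    (trimmed path ups fl nt) = trimmed (stepH path) ups (cong suc fl) nt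

Trimmed-U∷ : ∀ {p j i v} → Trimmed p (suc j) i v → Trimmed (suc p) j i (U ∷ v)
Trimmed-U∷ {v = []}    (trimmed () _ _ _)
Trimmed-U∷ {v = _ ∷ _} (trimmed path ups fl nt) = trimmed (stepU path) (cong suc ups) fl nt

Trimmed-D∷ : ∀ {p j i v} → Trimmed p j i v → Trimmed p (suc j) i (D ∷ v)
Trimmed-D∷ {v = []}    (trimmed path ups fl _)  = trimmed (stepD path) ups fl (λ ())
Trimmed-D∷ {v = _ ∷ _} (trimmed path ups fl nt) = trimmed (stepD path) ups fl nt

mutual
  trimmedPaths-sound : ∀ p j i {w} → w ∈ trimmedPaths p j i → Trimmed p j i w
  trimmedPaths-sound p j i w∈ with ∈-++⁻ (emptyPath p j i) w∈
  ... | inj₁ w∈e = emptyPath-sound p j i w∈e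
  ... | inj₂ w∈ with ∈-++⁻ (flatFirst p j i) w∈
  ...   | inj₁ w∈f = flatFirst-sound p j i w∈f
  ...   | inj₂ w∈ with ∈-++⁻ (upFirst p j i) w∈
  ...     | inj₁ w∈u = upFirst-sound p j i w∈u
  ...     | inj₂ w∈d = downFirst-sound p j i w∈d

  emptyPath-sound : ∀ p j i {w} → w ∈ emptyPath p j i → Trimmed p j i w
  emptyPath-sound zero zero zero (here refl) = trimmed done refl refl _

  flatFirst-sound : ∀ p j i {w} → w ∈ flatFirst p j i → Trimmed p j i w
  flatFirst-sound zero    (suc j) (suc i) w∈ with ∈-map⁻ (H₂ ∷_) w∈
  ... | v , v∈ , refl = Trimmed-H₂∷ (λ { refl → 1+n≢0 (proj₂ (Trimmed-[] t)) }) t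
    where t = trimmedPaths-sound zero (suc j) i v∈
  flatFirst-sound (suc p) j       (suc i) w∈ with ∈-map⁻ (H₂ ∷_) w∈
  ... | v , v∈ , refl = Trimmed-H₂∷ (λ { refl → 1+n≢0 (proj₁ (Trimmed-[] t)) }) t
    where t = trimmedPaths-sound (suc p) j i v∈

  upFirst-sound : ∀ p j i {w} → w ∈ upFirst p j i → Trimmed p j i w
  upFirst-sound (suc p) j i w∈ with ∈-map⁻ (U ∷_) w∈
  ... | v , v∈ , refl = Trimmed-U∷ (trimmedPaths-sound p (suc j) i v∈)

  downFirst-sound : ∀ p j i {w} → w ∈ downFirst p j i → Trimmed p j i w
  downFirst-sound p (suc j) i w∈ with ∈-map⁻ (D ∷_) w∈
  ... | v , v∈ , refl = Trimmed-D∷ (trimmedPaths-sound p j i v∈)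

flatFirst-suc : ∀ p j i → ¬ (p ≡ 0 × j ≡ 0) → flatFirst p j (suc i) ≡ map (H₂ ∷_) (trimmedPaths p j i)
flatFirst-suc zero    zero    i not00 = ⊥-elim (not00 (refl , refl))
flatFirst-suc zero    (suc j) i _     = refl
flatFirst-suc (suc p) j       i _     = refl

trimmedPaths-complete : ∀ {p j i w} → Trimmed p j i w → w ∈ trimmedPaths p j i
trimmedPaths-complete (trimmed done refl refl _) = here refl
trimmedPaths-complete {w = H₂ ∷ []} (trimmed _ _ _ nt) = ⊥-elim (nt refl)
trimmedPaths-complete {p} {j} {w = H₂ ∷ v@(_ ∷ _)} (trimmed (stepH path) ups refl nt) =
  ∈-++⁺ʳ (emptyPath p j _) (∈-++⁺ˡ (subst (H₂ ∷ v ∈_) (sym (flatFirst-suc p j _ not00))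
    (∈-map⁺ (H₂ ∷_) (trimmedPaths-complete t))))
  where
  t = trimmed path ups refl nt
  not00 : ¬ (p ≡ 0 × j ≡ 0)
  not00 (refl , refl) with Trimmed-no-up t
  ... | ()
trimmedPaths-complete {suc p} {j} {i} {U ∷ v} (trimmed (stepU path) refl refl nt) =
  ∈-++⁺ʳ (emptyPath (suc p) j i) (∈-++⁺ʳ (flatFirst (suc p) j i) (∈-++⁺ˡ
    (∈-map⁺ (U ∷_) (trimmedPaths-complete (trimmed path refl refl (NoTrailingH-∷⁻ U v nt))))))
trimmedPaths-complete {p} {suc j} {i} {D ∷ v} (trimmed (stepD path) refl refl nt) =
  ∈-++⁺ʳ (emptyPath p (suc j) i) (∈-++⁺ʳ (flatFirst p (suc j) i) (∈-++⁺ʳ (upFirst p (suc j) i)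
    (∈-map⁺ (D ∷_) (trimmedPaths-complete (trimmed path refl refl (NoTrailingH-∷⁻ D v nt))))))

head-∈-map : ∀ s {ws : List Word} {w} → w ∈ map (s ∷_) ws → head w ≡ just s
head-∈-map s w∈ with ∈-map⁻ (s ∷_) w∈
... | _ , _ , refl = refl

emptyPath-head : ∀ p j i {w} → w ∈ emptyPath p j i → head w ≡ nothing
emptyPath-head zero zero zero (here refl) = refl

flatFirst-head : ∀ p j i {w} → w ∈ flatFirst p j i → head w ≡ just H₂
flatFirst-head zero    (suc j) (suc i) = head-∈-map H₂
flatFirst-head (suc p) j       (suc i) = head-∈-map H₂

upFirst-head : ∀ p j i {w} → w ∈ upFirst p j i → head w ≡ just U
upFirst-head (suc p) j i = head-∈-map U

downFirst-head : ∀ p j i {w} → w ∈ downFirst p j i → head w ≡ just D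
downFirst-head p (suc j) i = head-∈-map D

mutual
  Unique-trimmedPaths : ∀ p j i → Unique (trimmedPaths p j i)
  Unique-trimmedPaths p j i =
    ++⁺ (Unique-emptyPath p j i)
        (++⁺ (Unique-flatFirst p j i) (++⁺ (Unique-upFirst p j i) (Unique-downFirst p j i) up∩down) flat∩rest)
        empty∩rest
    where
    up∩down : Disjoint (upFirst p j i) (downFirst p j i)
    up∩down (u , d) = case trans (sym (upFirst-head p j i u)) (downFirst-head p j i d) of λ ()
    flat∩rest : Disjoint (flatFirst p j i) (stepFirst p j i)
    flat∩rest (f , r) with ∈-++⁻ (upFirst p j i) r
    ... | inj₁ u = case trans (sym (flatFirst-head p j i f)) (upFirst-head p j i u) of λ ()
    ... | inj₂ d = case trans (sym (flatFirst-head p j i f)) (downFirst-head p j i d) of λ ()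
    empty∩rest : Disjoint (emptyPath p j i) (flatFirst p j i ++ stepFirst p j i)
    empty∩rest (e , r) with ∈-++⁻ (flatFirst p j i) r
    ... | inj₁ f = case trans (sym (emptyPath-head p j i e)) (flatFirst-head p j i f) of λ ()
    ... | inj₂ r′ with ∈-++⁻ (upFirst p j i) r′
    ...   | inj₁ u = case trans (sym (emptyPath-head p j i e)) (upFirst-head p j i u) of λ ()
    ...   | inj₂ d = case trans (sym (emptyPath-head p j i e)) (downFirst-head p j i d) of λ ()

  Unique-emptyPath : ∀ p j i → Unique (emptyPath p j i)
  Unique-emptyPath zero    zero    zero    = All.[] ∷ []
  Unique-emptyPath zero    zero    (suc i) = []
  Unique-emptyPath zero    (suc j) i       = []
  Unique-emptyPath (suc p) j       i       = []

  Unique-flatFirst : ∀ p j i → Unique (flatFirst p j i)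
  Unique-flatFirst zero    zero    i       = []
  Unique-flatFirst zero    (suc j) zero    = []
  Unique-flatFirst zero    (suc j) (suc i) = map⁺ ∷-injectiveʳ (Unique-trimmedPaths zero (suc j) i)
  Unique-flatFirst (suc p) j       zero    = []
  Unique-flatFirst (suc p) j       (suc i) = map⁺ ∷-injectiveʳ (Unique-trimmedPaths (suc p) j i)

  Unique-upFirst : ∀ p j i → Unique (upFirst p j i)
  Unique-upFirst zero    j i = []
  Unique-upFirst (suc p) j i = map⁺ ∷-injectiveʳ (Unique-trimmedPaths p (suc j) i)

  Unique-downFirst : ∀ p j i → Unique (downFirst p j i)
  Unique-downFirst p zero    i = []
  Unique-downFirst p (suc j) i = map⁺ ∷-injectiveʳ (Unique-trimmedPaths p j i)

private
  length-∷ : ∀ s (ws : List Word) {xs} → length (map (s ∷_) ws ++ xs) ≡ length ws + length xs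
  length-∷ s ws {xs} = trans (length-++ (map (s ∷_) ws)) (cong (_+ length xs) (length-map (s ∷_) ws))

  count-pascal : ∀ b M i → b * multichoose (suc M) i + b * multichoose M (suc i) ≡ b * multichoose (suc M) (suc i)
  count-pascal b M i = trans (sym (*-distribˡ-+ b _ _)) (cong (b *_) (sym (multichoose-suc M i)))

mutual
  length-trimmedPaths : ∀ p j i → length (trimmedPaths p j i) ≡ ballot p j * multichoose (udSteps p j) i
  length-trimmedPaths zero    zero    zero    = refl
  length-trimmedPaths zero    zero    (suc i) = sym (trans (*-identityˡ _) (multichoose-zero i))
  length-trimmedPaths zero    (suc j) zero    = length-stepFirst zero (suc j) zero (s≤s z≤n)
  length-trimmedPaths zero    (suc j) (suc i) = trans (length-∷ H₂ (trimmedPaths zero (suc j) i))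
    (trans (cong₂ _+_ (length-trimmedPaths zero (suc j) i) (length-stepFirst zero (suc j) (suc i) (s≤s z≤n)))
           (count-pascal 1 j i))
  length-trimmedPaths (suc p) j       zero    = length-stepFirst (suc p) j zero (s≤s z≤n)
  length-trimmedPaths (suc p) j       (suc i) = trans (length-∷ H₂ (trimmedPaths (suc p) j i))
    (trans (cong₂ _+_ (length-trimmedPaths (suc p) j i) (length-stepFirst (suc p) j (suc i) (s≤s z≤n)))
           (count-pascal (ballot (suc p) j) (udSteps p (suc j)) i))

  length-stepFirst : ∀ p j i → 0 < p + j →
                     length (stepFirst p j i) ≡ ballot p j * multichoose (pred (udSteps p j)) i
  length-stepFirst zero    zero    i ()
  length-stepFirst zero    (suc j) i _ = trans (length-map (D ∷_) (trimmedPaths zero j i)) (length-trimmedPaths zero j i)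
  length-stepFirst (suc p) zero    i _ =
    trans (length-∷ U (trimmedPaths p 1 i)) (trans (+-identityʳ _) (length-trimmedPaths p 1 i))
  length-stepFirst (suc p) (suc j) i _ = begin
    length (stepFirst (suc p) (suc j) i)
      ≡⟨ length-∷ U (trimmedPaths p (2 + j) i) ⟩
    length (trimmedPaths p (2 + j) i) + length (map (D ∷_) (trimmedPaths (suc p) j i))
      ≡⟨ cong₂ _+_ (length-trimmedPaths p (2 + j) i)
                   (trans (length-map (D ∷_) (trimmedPaths (suc p) j i)) (length-trimmedPaths (suc p) j i)) ⟩
    ballot p (2 + j) * multichoose M i + ballot (suc p) j * multichoose (suc (udSteps p (suc j))) i
      ≡⟨ cong (λ m → ballot p (2 + j) * multichoose M i + ballot (suc p) j * multichoose m i)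
              (sym (udSteps-suc p (suc j))) ⟩
    ballot p (2 + j) * multichoose M i + ballot (suc p) j * multichoose M i
      ≡⟨ *-distribʳ-+ (multichoose M i) (ballot p (2 + j)) _ ⟨
    ballot (suc p) (suc j) * multichoose M i
      ∎
    where
    M = udSteps p (2 + j)

-- Subwords and the avoidance criterion

Subword-∷ˡ⁻ : ∀ {x p w} → Subword (x ∷ p) w → Subword p w
Subword-∷ˡ⁻ (keep s) = skip s
Subword-∷ˡ⁻ (skip s) = skip (Subword-∷ˡ⁻ s)

Subword-∷⁻ : ∀ {x p w} → Subword (x ∷ p) (x ∷ w) → Subword p w
Subword-∷⁻ (keep s) = s
Subword-∷⁻ (skip s) = Subword-∷ˡ⁻ s

Subword-++ˡ : ∀ x {p y} → Subword p y → Subword p (x ++ y)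
Subword-++ˡ []      s = s
Subword-++ˡ (_ ∷ x) s = skip (Subword-++ˡ x s)

Subword-++⁺ : ∀ {p q x y} → Subword p x → Subword q y → Subword (p ++ q) (x ++ y)
Subword-++⁺ {x = x} nil s = Subword-++ˡ x s
Subword-++⁺ (keep s) t = keep (Subword-++⁺ s t)
Subword-++⁺ (skip s) t = skip (Subword-++⁺ s t)

Subword-flats : ∀ m v → m ≤ countH v → Subword (flats m) v
Subword-flats zero    v        _         = nil
Subword-flats (suc m) (U ∷ v)  m<        = skip (Subword-flats (suc m) v m<)
Subword-flats (suc m) (D ∷ v)  m<        = skip (Subword-flats (suc m) v m<)
Subword-flats (suc m) (H₂ ∷ v) (s≤s m≤) = keep (Subword-flats m v m≤)

countH-mono : ∀ {p w} → Subword p w → countH p ≤ countH w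
countH-mono nil                   = z≤n
countH-mono {U ∷ _}  (keep s)     = countH-mono s
countH-mono {D ∷ _}  (keep s)     = countH-mono s
countH-mono {H₂ ∷ _} (keep s)     = s≤s (countH-mono s)
countH-mono {w = U ∷ _}  (skip s) = countH-mono s
countH-mono {w = D ∷ _}  (skip s) = countH-mono s
countH-mono {w = H₂ ∷ _} (skip s) = m≤n⇒m≤1+n (countH-mono s)

countH-++ : ∀ x y → countH (x ++ y) ≡ countH x + countH y
countH-++ []       y = refl
countH-++ (U ∷ x)  y = countH-++ x y
countH-++ (D ∷ x)  y = countH-++ x y
countH-++ (H₂ ∷ x) y = cong suc (countH-++ x y)

countH-flats : ∀ m → countH (flats m) ≡ m
countH-flats zero    = refl
countH-flats (suc m) = cong suc (countH-flats m)

¬Subword-U-flats : ∀ n {p} → ¬ Subword (U ∷ p) (flats n)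
¬Subword-U-flats (suc n) (skip s) = ¬Subword-U-flats n s

Subword-U-flats⁻ : ∀ a {p w} → Subword (U ∷ p) (flats a ++ w) → Subword (U ∷ p) w
Subword-U-flats⁻ zero    s        = s
Subword-U-flats⁻ (suc a) (skip s) = Subword-U-flats⁻ a s

¬Subword-D-flats : ∀ q b → ¬ Subword (q ++ D ∷ []) (flats b)
¬Subword-D-flats []       (suc b) (skip s) = ¬Subword-D-flats [] b s
¬Subword-D-flats (H₂ ∷ q) (suc b) (keep s) = ¬Subword-D-flats q b s
¬Subword-D-flats (_ ∷ q)  (suc b) (skip s) = ¬Subword-D-flats (_ ∷ q) b s

Subword-D-flats⁻ : ∀ q x b → Subword (q ++ D ∷ []) (x ++ flats b) → Subword (q ++ D ∷ []) x
Subword-D-flats⁻ q       []      b s        = ⊥-elim (¬Subword-D-flats q b s)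
Subword-D-flats⁻ []      (D ∷ x) b (keep s) = keep nil
Subword-D-flats⁻ (_ ∷ q) (_ ∷ x) b (keep s) = keep (Subword-D-flats⁻ q x b s)
Subword-D-flats⁻ q       (_ ∷ x) b (skip s) = skip (Subword-D-flats⁻ q x b s)

lifted : ℕ → Word → ℕ → Word
lifted a v b = flats a ++ U ∷ (v ++ flats b)

avoids-lifted⇔ : ∀ k a b {v} → PathFrom 1 v → NoTrailingH v →
                 Avoids (lifted a v b) (pattern-UHD (2 + k)) ⇔ countH v ≤ k
avoids-lifted⇔ k a b {v} path nt = mk⇔ bounded avoids
  where
  P = flats (suc k) ++ D ∷ []
  countH-P : countH P ≡ suc k
  countH-P = trans (countH-++ (flats (suc k)) (D ∷ [])) (trans (+-identityʳ _) (countH-flats (suc k)))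

  avoids : countH v ≤ k → Avoids (lifted a v b) (pattern-UHD (2 + k))
  avoids v≤k s = <⇒≱ (s≤s v≤k) (subst (_≤ countH v) countH-P
    (countH-mono (Subword-D-flats⁻ (flats (suc k)) v b (Subword-∷⁻ (Subword-U-flats⁻ a s)))))

  embed : suc k ≤ countH v → Subword (pattern-UHD (2 + k)) (lifted a v b)
  embed k<v with PathFrom-endsWithD path (λ { refl → case path of λ () }) nt
  ... | v′ , refl = Subword-++ˡ (flats a) (keep (subst (Subword P) (sym (++-assoc v′ (D ∷ []) (flats b)))
        (Subword-++⁺ (Subword-flats (suc k) v′ k<v′) (keep nil))))
    where
    k<v′ : suc k ≤ countH v′
    k<v′ = subst (suc k ≤_) (trans (countH-++ v′ (D ∷ [])) (+-identityʳ _)) k<v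

  bounded : Avoids (lifted a v b) (pattern-UHD (2 + k)) → countH v ≤ k
  bounded avoid with countH v ≤? k
  ... | yes v≤k = v≤k
  ... | no  v≰k = ⊥-elim (avoid (embed (≰⇒> v≰k)))

-- Decomposing a Schröder path

splitTrailingFlats : ∀ w → ∃[ v ] ∃[ b ] w ≡ v ++ flats b × NoTrailingH v
splitTrailingFlats [] = [] , 0 , refl , _
splitTrailingFlats (x ∷ w) with splitTrailingFlats w
splitTrailingFlats (U ∷ w)  | [] , b , w≡ , _  = U ∷ [] , b , cong (U ∷_) w≡ , λ ()
splitTrailingFlats (D ∷ w)  | [] , b , w≡ , _  = D ∷ [] , b , cong (D ∷_) w≡ , λ ()
splitTrailingFlats (H₂ ∷ w) | [] , b , w≡ , _  = [] , suc b , cong (H₂ ∷_) w≡ , _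
splitTrailingFlats (x ∷ w)  | y ∷ v , b , w≡ , nt = x ∷ y ∷ v , b , cong (x ∷_) w≡ , nt

data Decomposition : Word → Set where
  flat : ∀ a → Decomposition (flats a)
  lift : ∀ a {v} b → PathFrom 1 v → NoTrailingH v → Decomposition (lifted a v b)

decompose : ∀ {w} → IsSchroder w → Decomposition w
decompose done = flat 0
decompose (stepH p) with decompose p
... | flat a            = flat (suc a)
... | lift a b path nt  = lift (suc a) b path nt
decompose {U ∷ w} (stepU p) with splitTrailingFlats w
... | v , b , refl , nt = lift 0 b (PathFrom-++flats⁻ v b p) nt

semilength-lifted : ∀ a v b → semilength (lifted a v b) ≡ a + (suc (countU v) + countH v + b)
semilength-lifted a v b = begin
  semilength (lifted a v b)
    ≡⟨ semilength-++ (flats a) _ ⟩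
  semilength (flats a) + suc (semilength (v ++ flats b))
    ≡⟨ cong₂ (λ x y → x + suc y) (semilength-flats a) (semilength-++ v _) ⟩
  a + suc (semilength v + semilength (flats b))
    ≡⟨ cong₂ (λ x y → a + suc (x + y)) (semilength≡countU+countH v) (semilength-flats b) ⟩
  a + (suc (countU v) + countH v + b)
    ∎

leadingFlats : Word → ℕ
leadingFlats (H₂ ∷ w) = suc (leadingFlats w)
leadingFlats _        = 0

leadingFlats-lifted : ∀ a v b → leadingFlats (lifted a v b) ≡ a
leadingFlats-lifted zero    v b = refl
leadingFlats-lifted (suc a) v b = cong suc (leadingFlats-lifted a v b)

flats≢∷++flats : ∀ b x v {b′} → NoTrailingH (x ∷ v) → flats b ≢ x ∷ (v ++ flats b′)
flats≢∷++flats zero    _ _       _  ()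
flats≢∷++flats (suc b) x []      nt eq = nt (sym (∷-injectiveˡ eq))
flats≢∷++flats (suc b) x (y ∷ v) nt eq = flats≢∷++flats b y v nt (∷-injectiveʳ eq)

++flats-cancel : ∀ v v′ b b′ → NoTrailingH v → NoTrailingH v′ →
                 v ++ flats b ≡ v′ ++ flats b′ → v ≡ v′
++flats-cancel []      []        _ _ _   _   _  = refl
++flats-cancel []      (x ∷ v′)  b _ _   nt′ eq = ⊥-elim (flats≢∷++flats b x v′ nt′ eq)
++flats-cancel (x ∷ v) []        _ b nt  _   eq = ⊥-elim (flats≢∷++flats b x v nt (sym eq))
++flats-cancel (x ∷ v) (x′ ∷ v′) b b′ nt nt′ eq = cong₂ _∷_ (∷-injectiveˡ eq)
  (++flats-cancel v v′ b b′ (NoTrailingH-∷⁻ x v nt) (NoTrailingH-∷⁻ x′ v′ nt′) (∷-injectiveʳ eq))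

lifted-injective : ∀ {a v b a′ v′ b′} → NoTrailingH v → NoTrailingH v′ →
                   lifted a v b ≡ lifted a′ v′ b′ → a ≡ a′ × v ≡ v′
lifted-injective {a} {v} {b} {a′} {v′} {b′} nt nt′ eq
  with trans (sym (leadingFlats-lifted a v b)) (trans (cong leadingFlats eq) (leadingFlats-lifted a′ v′ b′))
... | refl = refl , ++flats-cancel v v′ b b′ nt nt′ (∷-injectiveʳ (++-cancelˡ (flats a) _ _ eq))

-- Counting the avoiders

private
  rearrange : ∀ a h i b → a + (h + i + b) ≡ h + (i + (a + b))
  rearrange = solve-∀

a+[h+i+[n∸h∸i∸a]]≡n : ∀ {n h i a} → h ≤ n → i ≤ n ∸ h → a ≤ n ∸ h ∸ i →
                      a + (h + i + (n ∸ h ∸ i ∸ a)) ≡ n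
a+[h+i+[n∸h∸i∸a]]≡n {n} {h} {i} {a} h≤n i≤ a≤ = begin
  a + (h + i + (n ∸ h ∸ i ∸ a))       ≡⟨ rearrange a h i _ ⟩
  h + (i + (a + (n ∸ h ∸ i ∸ a)))     ≡⟨ cong (λ x → h + (i + x)) (m+[n∸m]≡n a≤) ⟩
  h + (i + (n ∸ h ∸ i))               ≡⟨ cong (h +_) (m+[n∸m]≡n i≤) ⟩
  h + (n ∸ h)                         ≡⟨ m+[n∸m]≡n h≤n ⟩
  n                                   ∎

a+[h+i+b]≡n⇒bounds : ∀ {n h i a b} → a + (h + i + b) ≡ n →
               h ≤ n × i ≤ n ∸ h × a ≤ n ∸ h ∸ i × n ∸ h ∸ i ∸ a ≡ b
a+[h+i+b]≡n⇒bounds {h = h} {i} {a} {b} refl rewrite rearrange a h i b =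
  m≤m+n h _ , subst (i ≤_) (sym n∸h) (m≤m+n i _) , subst (a ≤_) (sym n∸h∸i) (m≤m+n a b) ,
  trans (cong (_∸ a) n∸h∸i) (m+n∸m≡n a b)
  where
  n∸h : h + (i + (a + b)) ∸ h ≡ i + (a + b)
  n∸h = m+n∸m≡n h _
  n∸h∸i : h + (i + (a + b)) ∸ h ∸ i ≡ a + b
  n∸h∸i = trans (cong (_∸ i) n∸h) (m+n∸m≡n i _)

-- code h i a v stands for H₂^a U v H₂^b with b = n - h - i - a, where U v has h up-steps and
-- v has i flat steps.
record Code : Set where
  constructor code
  field
    h i a : ℕ
    core  : Word

data ValidCode (n k : ℕ) : Code → Set where
  valid : ∀ {q i a v} → suc q ≤ n → i ≤ k ⊓ (n ∸ suc q) → a ≤ n ∸ suc q ∸ i →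
          v ∈ trimmedPaths q 1 i → ValidCode n k (code (suc q) i a v)

codeBlock : ℕ → ℕ → ℕ → List Code
codeBlock h i a = map (code h i a) (trimmedPaths (pred h) 1 i)

iBlock : ℕ → ℕ → ℕ → List Code
iBlock n h i = concatUpTo (n ∸ h ∸ i) (codeBlock h i)

hBlock : ℕ → ℕ → ℕ → List Code
hBlock n k h = concatUpTo (k ⊓ (n ∸ h)) (iBlock n h)

codes : ℕ → ℕ → List Code
codes n k = concatFrom1 n (hBlock n k)

∈-codeBlock⁻ : ∀ {h i a c} → c ∈ codeBlock h i a → ∃[ v ] c ≡ code h i a v × v ∈ trimmedPaths (pred h) 1 i
∈-codeBlock⁻ {h} {i} {a} c∈ with ∈-map⁻ (code h i a) c∈
... | v , v∈ , refl = v , refl , v∈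

codeBlock-tags : ∀ {h i a c} → c ∈ codeBlock h i a → Code.h c ≡ h × Code.i c ≡ i × Code.a c ≡ a
codeBlock-tags c∈ with ∈-codeBlock⁻ c∈
... | _ , refl , _ = refl , refl , refl

iBlock-tags : ∀ {n h i c} → c ∈ iBlock n h i → Code.h c ≡ h × Code.i c ≡ i
iBlock-tags {n} {h} {i} c∈ with ∈-concatUpTo⁻ (n ∸ h ∸ i) (codeBlock h i) c∈
... | _ , _ , c∈′ = proj₁ (codeBlock-tags c∈′) , proj₁ (proj₂ (codeBlock-tags c∈′))

hBlock-tag : ∀ {n k h c} → c ∈ hBlock n k h → Code.h c ≡ h
hBlock-tag {n} {k} {h} c∈ with ∈-concatUpTo⁻ (k ⊓ (n ∸ h)) (iBlock n h) c∈
... | i , _ , c∈′ = proj₁ (iBlock-tags {n} {h} {i} c∈′)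

∈-codes⁻ : ∀ n k {c} → c ∈ codes n k → ValidCode n k c
∈-codes⁻ n k c∈ with ∈-concatFrom1⁻ n (hBlock n k) c∈
... | q , q<n , c∈ with ∈-concatUpTo⁻ (k ⊓ (n ∸ suc q)) (iBlock n (suc q)) c∈
...   | i , i≤ , c∈ with ∈-concatUpTo⁻ (n ∸ suc q ∸ i) (codeBlock (suc q) i) c∈
...     | a , a≤ , c∈ with ∈-codeBlock⁻ c∈
...       | v , refl , v∈ = valid q<n i≤ a≤ v∈

∈-codes⁺ : ∀ n k {c} → ValidCode n k c → c ∈ codes n k
∈-codes⁺ n k (valid {q} {i} {a} q<n i≤ a≤ v∈) =
  ∈-concatFrom1⁺ n (hBlock n k) q<n (∈-concatUpTo⁺ (k ⊓ (n ∸ suc q)) (iBlock n (suc q)) i≤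
    (∈-concatUpTo⁺ (n ∸ suc q ∸ i) (codeBlock (suc q) i) a≤ (∈-map⁺ (code (suc q) i a) v∈)))

Unique-codes : ∀ n k → Unique (codes n k)
Unique-codes n k = Unique-concatFrom1 n Code.h
  (λ h → Unique-concatUpTo (k ⊓ (n ∸ h)) Code.i
    (λ i → Unique-concatUpTo (n ∸ h ∸ i) Code.a
      (λ a → map⁺ (cong Code.core) (Unique-trimmedPaths (pred h) 1 i))
      (λ {a} → proj₂ ∘ proj₂ ∘ codeBlock-tags {h} {i} {a}))
    (λ {i} → proj₂ ∘ iBlock-tags {n} {h} {i}))
  (λ {h} → hBlock-tag {n} {k} {h})

Avoider : ℕ → ℕ → Word → Set
Avoider n k w = IsSchroder w × semilength w ≡ n × Avoids w (pattern-UHD (2 + k))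

encode : ℕ → Code → Word
encode n (code h i a v) = lifted a v (n ∸ h ∸ i ∸ a)

encode-avoider : ∀ n k {c} → ValidCode n k c → Avoider n k (encode n c)
encode-avoider n k (valid {q} {i} {a} {v} q<n i≤ a≤ v∈) with trimmedPaths-sound q 1 i v∈
... | trimmed path refl refl nt =
  PathFrom-flats++ a (stepU (PathFrom-++flats b path)) ,
  trans (semilength-lifted a v b) (a+[h+i+[n∸h∸i∸a]]≡n q<n (≤-trans i≤ (m⊓n≤n k _)) a≤) ,
  Equivalence.from (avoids-lifted⇔ k a b path nt) (≤-trans i≤ (m⊓n≤m k _))
  where
  b = n ∸ suc q ∸ i ∸ a

decode : ∀ n k {w} → Avoider n k w → w ≡ flats n ⊎ ∃[ c ] ValidCode n k c × encode n c ≡ w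
decode n k (schröder , semilength≡n , avoids) with decompose schröder
... | flat a = inj₁ (cong flats (trans (sym (semilength-flats a)) semilength≡n))
... | lift a {v} b path nt with a+[h+i+b]≡n⇒bounds (trans (sym (semilength-lifted a v b)) semilength≡n)
...   | q<n , i≤ , a≤ , b≡ =
  inj₂ (code (suc (countU v)) (countH v) a v ,
        valid q<n (⊓-glb (Equivalence.to (avoids-lifted⇔ k a b path nt) avoids) i≤) a≤
              (trimmedPaths-complete (trimmed path refl refl nt)) ,
        cong (lifted a v) b≡)

encode-injective : ∀ n k {c c′} → ValidCode n k c → ValidCode n k c′ → encode n c ≡ encode n c′ → c ≡ c′
encode-injective n k (valid {q} {i} {a} {v} _ _ _ v∈) (valid {q′} {i′} {a′} {v′} _ _ _ v′∈) eq
  with trimmedPaths-sound q 1 i v∈ | trimmedPaths-sound q′ 1 i′ v′∈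
... | trimmed _ refl refl nt | trimmed _ refl refl nt′ with lifted-injective {a} {v} {_} {a′} {v′} nt nt′ eq
...   | refl , refl = refl

avoiders : ℕ → ℕ → List Word
avoiders n k = flats n ∷ map (encode n) (codes n k)

∈-avoiders⁻ : ∀ n k {w} → w ∈ avoiders n k → Avoider n k w
∈-avoiders⁻ n k (here refl) = PathFrom-flats n , semilength-flats n , ¬Subword-U-flats n
∈-avoiders⁻ n k (there w∈) with ∈-map⁻ (encode n) w∈
... | c , c∈ , refl = encode-avoider n k (∈-codes⁻ n k c∈)

∈-avoiders⁺ : ∀ n k {w} → Avoider n k w → w ∈ avoiders n k
∈-avoiders⁺ n k avoider with decode n k avoider
... | inj₁ refl              = here refl
... | inj₂ (c , c-valid , refl) = there (∈-map⁺ (encode n) (∈-codes⁺ n k c-valid))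

Unique-avoiders : ∀ n k → Unique (avoiders n k)
Unique-avoiders n k = All.tabulate flats∉ ∷ Unique-map-injectiveOn (encode n) (Unique-codes n k)
  (λ c∈ c′∈ → encode-injective n k (∈-codes⁻ n k c∈) (∈-codes⁻ n k c′∈))
  where
  flats∉ : ∀ {w} → w ∈ map (encode n) (codes n k) → flats n ≢ w
  flats∉ w∈ flats≡w with ∈-map⁻ (encode n) w∈
  ... | code _ _ a _ , _ , refl =
    ¬Subword-U-flats n (subst (Subword (U ∷ [])) (sym flats≡w) (Subword-++ˡ (flats a) (keep nil)))

length-iBlock : ∀ n q i →
                length (iBlock n (suc q) i) ≡ multichoose (2 * suc q ∸ 1) i * ((n ∸ suc q ∸ i) + 1) * catalan (suc q)
length-iBlock n q i = begin
  length (iBlock n (suc q) i)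
    ≡⟨ length-concatUpTo r (codeBlock (suc q) i) ⟩
  sumTo r (length ∘ codeBlock (suc q) i)
    ≡⟨ sumTo-cong r (λ a → length-map (code (suc q) i a) (trimmedPaths q 1 i)) ⟩
  sumTo r (λ _ → length (trimmedPaths q 1 i))
    ≡⟨ sumTo-const r _ ⟩
  (r + 1) * length (trimmedPaths q 1 i)
    ≡⟨ cong ((r + 1) *_) (length-trimmedPaths q 1 i) ⟩
  (r + 1) * (ballot q 1 * multichoose (udSteps q 1) i)
    ≡⟨ cong₂ (λ c m → (r + 1) * (c * multichoose m i)) (ballot≡catalan q) udSteps≡ ⟩
  (r + 1) * (catalan (suc q) * multichoose (2 * suc q ∸ 1) i)
    ≡⟨ reorder (r + 1) (catalan (suc q)) _ ⟩
  multichoose (2 * suc q ∸ 1) i * (r + 1) * catalan (suc q)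
    ∎
  where
  r = n ∸ suc q ∸ i
  udSteps≡ : udSteps q 1 ≡ 2 * suc q ∸ 1
  udSteps≡ = trans (udSteps-1 q) (cong (q +_) (sym (+-identityʳ (suc q))))
  reorder : ∀ x y z → x * (y * z) ≡ z * x * y
  reorder = solve-∀

length-codes : ∀ n k → length (codes n k) ≡
  sumFrom1 n (λ h → sumTo (k ⊓ (n ∸ h)) (λ i → multichoose (2 * h ∸ 1) i * ((n ∸ h ∸ i) + 1) * catalan h))
length-codes n k = trans (length-concatFrom1 n (hBlock n k)) (sumFrom1-cong n λ q →
  trans (length-concatUpTo (k ⊓ (n ∸ suc q)) (iBlock n (suc q))) (sumTo-cong (k ⊓ (n ∸ suc q)) (length-iBlock n q)))

mainTheorem7 : ∀ (n k : ℕ) → 1 < k → CountIs n (pattern-UHD k) (formula n k)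
mainTheorem7 n zero          ()
mainTheorem7 n (suc zero)    (s≤s ())
mainTheorem7 n (suc (suc k)) _ =
  avoiders n k ,
  Unique-avoiders n k ,
  (λ w → mk⇔ (∈-avoiders⁻ n k) (∈-avoiders⁺ n k)) ,
  cong suc (trans (length-map (encode n) (codes n k)) (length-codes n k))
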